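{- For integers $C\geq 3$, $L\geq 3$ and $k\in\{1,\dots,C-2\}$, $\gamma_{P,k}(WKP_{(C,L)})= (C-k-1)C^{L-2}$.
   Context: For a graph $G$, $S\subseteq V(G)$ and an integer $k\ge 0$, define $\mathcal{P}^0_{G,k}(S)=N_G[S]$ (closed neighbourhood of $S$) and $\mathcal{P}^{i+1}_{G,k}(S)=\bigcup\{N_G[v] : v\in \mathcal{P}^i_{G,k}(S),\ |N_G[v]\setminus \mathcal{P}^i_{G,k}(S)|\le k\}$. These sets increase and stabilize at a set $\mathcal{P}^\infty_{G,k}(S)$. A $k$-power dominating set ($k$-PDS) is a set $S$ with $\mathcal{P}^\infty_{G,k}(S)=V(G)$, and $\gamma_{P,k}(G)$ is the minimum cardinality of a $k$-PDS of $G$. Let $[C]_0=\{0,\dots,C-1\}$. The WK-Pyramid network $WKP_{(C,L)}$ has vertex set $\{(r,(a_r a_{r-1}\cdots a_1)) : r\in\{1,\dots,L\},\ a_i\in[C]_0\}\cup\{(0,(1))\}$; a vertex $(r,(a_r\cdots a_1))$ is said to be at level $r$. The vertex $(0,(1))$ is adjacent to every vertex at level $1$. A vertex $(r,(a_r\cdots a_1))$ with $r>0$ is adjacent to: (1) the vertices $(r,(a_r\cdots a_2 b))$ with $b\in[C]_0$, $b\ne a_1$; (2) the vertex $(r,(a_r\cdots a_{j+1}a_{j-1}(a_j)^{j-1}))$ if there is a $j$ with $2\le j\le r$, $a_{j-1}=a_{j-2}=\cdots=a_1$ and $a_j\ne a_{j-1}$, where $(a_j)^{j-1}$ denotes $a_j$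 repeated $j-1$ times; (3) the vertices $(r+1,(a_r\cdots a_1 b))$ for $b\in[C]_0$ (when $r<L$); (4) the vertex $(r-1,(a_r\cdots a_2))$ (for $r=1$ this is $(0,(1))$). -}

module Defs where

open import Data.Nat using (ℕ; zero; suc; _≤ᵇ_)
open import Data.Bool using (Bool; true; false; _∧_; _∨_; not; if_then_else_)
open import Data.Fin using (Fin; _≟_)
open import Data.List using (List; []; _∷_; _++_; replicate; map; concatMap; allFin; upTo)
open import Data.Bool.ListAction using (any)
open import Data.List.Properties using (≡-dec)
open import Data.Maybe using (Maybe; just; nothing)
open import Relation.Nullary.Decidable using (⌊_⌋)
open import Data.List.Membership.Propositional using (_∈_)
open import Data.List.Relation.Unary.All using (All)
open import Data.Product using (∃-syntax)
open import Relation.Binary.PropositionalEquality using (_≡_)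

-- A vertex (r,(a_r ... a_1)) of WKP_(C,L) is encoded as the list
-- a_1 ∷ a_2 ∷ ... ∷ a_r ∷ []  (least significant digit first).
-- The apex (0,(1)) is encoded as the empty list [].
Word : ℕ → Set
Word C = List (Fin C)

_==_ : ∀ {C} → Word C → Word C → Bool
_==_ {C} u v = ⌊ ≡-dec _≟_ u v ⌋

_=ᶠ_ : ∀ {C} → Fin C → Fin C → Bool
a =ᶠ b = ⌊ a ≟ b ⌋

wordsOfLength : (C : ℕ) → ℕ → List (Word C)
wordsOfLength C zero = [] ∷ []
wordsOfLength C (suc r) = concatMap (λ w → map (λ b → b ∷ w) (allFin C)) (wordsOfLength C r)

vertices : (C L : ℕ) → List (Word C)
vertices C L = concatMap (wordsOfLength C) (upTo (suc L))

-- rule (2): with a_1 = ... = a_{j-1} = c (run of length n = j-1 ≥ 1),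
-- a_j = d ≠ c, the vertex a_r...a_{j+1} a_{j-1} (a_j)^{j-1}, i.e. in our
-- encoding  c^n ∷ d ∷ rest  ↦  d^n ∷ c ∷ rest.
rule2-go : ∀ {C} → Fin C → ℕ → Word C → Maybe (Word C)
rule2-go c n [] = nothing
rule2-go c n (d ∷ rest) =
  if d =ᶠ c then rule2-go c (suc n) rest else just (replicate n d ++ (c ∷ rest))

rule2 : ∀ {C} → Word C → Maybe (Word C)
rule2 [] = nothing
rule2 (c ∷ xs) = rule2-go c 1 xs

isJust≡ : ∀ {C} → Maybe (Word C) → Word C → Bool
isJust≡ (just w) u = w == u
isJust≡ nothing u = false

sibling : ∀ {C} → Word C → Word C → Bool
sibling (a ∷ t) (b ∷ s) = not (a =ᶠ b) ∧ (t == s)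
sibling _ _ = false

parentOf : ∀ {C} → Word C → Word C → Bool
parentOf u [] = false
parentOf u (b ∷ v) = u == v

adj : ∀ {C} → Word C → Word C → Bool
adj u v = sibling u v ∨ isJust≡ (rule2 u) v ∨ isJust≡ (rule2 v) u
          ∨ parentOf u v ∨ parentOf v u

inClosedNbhd : ∀ {C} → Word C → Word C → Bool
inClosedNbhd v u = (u == v) ∨ adj v u

countTrue : ∀ {A : Set} → (A → Bool) → List A → ℕ
countTrue p [] = zero
countTrue p (x ∷ xs) = if p x then suc (countTrue p xs) else countTrue p xs

P : (C L k : ℕ) → List (Word C) → ℕ → Word C → Bool
P C L k S zero u = any (λ s → inClosedNbhd s u) S
P C L k S (suc i) u =
  any (λ v → P C L k S i v
             ∧ (countTrue (λ w → inClosedNbhd v w ∧ not (P C L k S i w)) (vertices C L) ≤ᵇ k)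
             ∧ inClosedNbhd v u)
      (vertices C L)

isKPDS : (C L k : ℕ) → List (Word C) → Set
isKPDS C L k S =
  All (_∈ vertices C L) S × (∃[ i ] (∀ v → v ∈ vertices C L → P C L k S i v ≡ true))
  where open import Data.Product using (_×_)

-- γ_{P,k}(WKP_(C,L)) = n : n is the minimum cardinality of a k-PDS
-- (lists may repeat elements; a minimum-length list has none)
γPk≡ : (C L k n : ℕ) → Set
γPk≡ C L k n =
  (∃[ S ] (isKPDS C L k S × Data.List.length S ≡ n))
  × (∀ S → isKPDS C L k S → n Data.Nat.≤ Data.List.length S)
  where open import Data.Product using (_×_)
        import Data.List
        import Data.Nat

-- Lower bound: for a vertex q at level L−2 call a child a∷q hit when S contains a∷q or one of
-- its children.  If k+2 children of q are not hit, the leaves b∷a∷q with a ≠ b among them form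
-- a fort: such a leaf is adjacent only to its siblings, its parent a∷q and its rule-(2) partner
-- a∷b∷q.  The partner is another leaf of the fort, while a sibling or the parent sees the k+1
-- unobserved leaves c∷a∷q and so can never force.  Hence every q has at least C−k−1 hit
-- children, and each vertex of S hits only one vertex.
--
-- Upper bound: take for S the vertices a∷r∷q at level L−1 whose digit a is one of the C−k−1
-- cyclic successors of r.  Levels L−1 and L−2 are observed at once, four forcing rounds along
-- rule-(2) and parent–child edges reach every leaf, and the levels above L−2 follow one per
-- round, each vertex being forced by one of its children.

module Submission where

open import Defs hiding (sibling)
open import Defs using () renaming (sibling to siblingᵇ)
open import Data.Nat using (ℕ; _≤_; _∸_; _*_; _^_)
open import Data.Nat as ℕ using (zero; suc; pred; _+_; _<_; _≤′_; z≤n; s≤s; NonZero)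
open import Data.Nat.Properties as ℕ using ()
open import Data.Nat.DivMod
  using (_%_; _mod_; m%n<n; %-distribˡ-+; m%n%n≡m%n; %-remove-+ˡ; %-remove-+ʳ; m<n⇒m%n≡m)
open import Data.Nat.Divisibility using (∣-refl)
open import Data.Bool using (Bool; true; false; _∧_; not; T)
open import Data.Bool.Properties using (T-≡; T-∧; T-∨)
open import Data.Fin as Fin using (Fin; toℕ; _≟_)
open import Data.Fin.Properties using (toℕ-injective; toℕ<n; toℕ-fromℕ<)
open import Data.List
  using (List; []; _∷_; _++_; replicate; map; concatMap; allFin; upTo; applyUpTo; filter; drop; length)
open import Data.List.Properties
  using (≡-dec; ∷-injectiveˡ; length-map; length-++; length-replicate; length-tabulate; length-applyUpTo;
         filter-notAll)
open import Data.List.Membership.Propositional using (_∈_; find; lose)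
open import Data.List.Membership.Propositional.Properties
  using (∈-map⁺; ∈-map⁻; ∈-concatMap⁺; ∈-concatMap⁻; ∈-allFin; ∈-upTo⁺; ∈-upTo⁻; ∈-applyUpTo⁺;
         ∈-filter⁺; ∈-filter⁻; ∈-++⁺ˡ; ∈-++⁺ʳ)
open import Data.List.Relation.Unary.Any as Any using (Any; here; there)
open import Data.List.Relation.Unary.Any.Properties using (any⁺; any⁻)
open import Data.List.Relation.Unary.All as All using (All; []; _∷_)
open import Data.List.Relation.Unary.AllPairs using ([]; _∷_)
open import Data.List.Relation.Unary.Unique.Propositional using (Unique)
open import Data.List.Relation.Unary.Unique.Propositional.Properties as Unique using ()
open import Data.Maybe using (just)
open import Data.Maybe.Properties using (just-injective)
open import Data.Product using (∃-syntax; _×_; _,_; proj₂)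
open import Data.Empty using (⊥-elim)
open import Data.Sum as Sum using (_⊎_; inj₁; inj₂; [_,_])
open import Function using (_∘_; id; _⇔_; Equivalence)
open import Function.Construct.Identity using (⇔-id)
open import Function.Construct.Composition using (_⇔-∘_)
open import Data.Sum.Function.Propositional using (_⊎-⇔_)
open import Relation.Nullary using (¬_; Dec; yes; no; contradiction; ¬?)
open import Relation.Nullary.Decidable
  using (toWitness; fromWitness; fromWitnessFalse; isYes≗does; dec-true; dec-false; T?)
open import Relation.Binary.Definitions using (DecidableEquality)
open import Relation.Binary.PropositionalEquality
  using (_≡_; _≢_; refl; sym; trans; cong; cong₂; subst; ≢-sym; module ≡-Reasoning)

T-∧⁺ : ∀ {a b} → T a → T b → T (a ∧ b)
T-∧⁺ ta tb = Equivalence.from T-∧ (ta , tb)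

T-∧⁻ : ∀ {a b} → T (a ∧ b) → T a × T b
T-∧⁻ = Equivalence.to T-∧

T-not⁺ : ∀ {a} → ¬ T a → T (not a)
T-not⁺ {false} _ = _
T-not⁺ {true} ¬t = ¬t _

T-not⁻ : ∀ {a} → T (not a) → ¬ T a
T-not⁻ {false} _ ()

=ᶠ-refl : ∀ {C} (a : Fin C) → (a =ᶠ a) ≡ true
=ᶠ-refl a = trans (isYes≗does (a ≟ a)) (dec-true (a ≟ a) refl)

=ᶠ-≢ : ∀ {C} {a b : Fin C} → a ≢ b → (a =ᶠ b) ≡ false
=ᶠ-≢ {a = a} {b} a≢b = trans (isYes≗does (a ≟ b)) (dec-false (a ≟ b) a≢b)

_≟ʷ_ : ∀ {C} → DecidableEquality (Word C)
_≟ʷ_ = ≡-dec _≟_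

countTrue≡length∘filter : ∀ {A : Set} (p : A → Bool) xs →
                          countTrue p xs ≡ length (filter (T? ∘ p) xs)
countTrue≡length∘filter p [] = refl
countTrue≡length∘filter p (x ∷ xs) with p x
... | true = cong suc (countTrue≡length∘filter p xs)
... | false = countTrue≡length∘filter p xs

module _ {A : Set} (_≟ᴬ_ : DecidableEquality A) where

  unique⊆⇒length≤ : ∀ {xs ys : List A} → Unique xs → (∀ {x} → x ∈ xs → x ∈ ys) →
                    length xs ≤ length ys
  unique⊆⇒length≤ {[]} _ _ = z≤n
  unique⊆⇒length≤ {x ∷ xs} {ys} (x∉xs ∷ xs-unique) xs⊆ys =
    ℕ.≤-trans (s≤s (unique⊆⇒length≤ xs-unique xs⊆others)) (filter-notAll ≢x? ys x∈ys)
    where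
    ≢x? = λ y → ¬? (y ≟ᴬ x)

    xs⊆others : ∀ {w} → w ∈ xs → w ∈ filter ≢x? ys
    xs⊆others w∈xs = ∈-filter⁺ ≢x? (xs⊆ys (there w∈xs)) (≢-sym (All.lookup x∉xs w∈xs))

    x∈ys : Any (λ y → ¬ ¬ y ≡ x) ys
    x∈ys = Any.map (λ { refl ¬x≡x → ¬x≡x refl }) (xs⊆ys (here refl))

  countTrue-≤ : ∀ (p : A → Bool) {xs ys} → Unique xs →
                (∀ {x} → x ∈ xs → T (p x) → x ∈ ys) → countTrue p xs ≤ length ys
  countTrue-≤ p {xs} xs-unique true⊆ys
    rewrite countTrue≡length∘filter p xs =
    unique⊆⇒length≤ (Unique.filter⁺ (T? ∘ p) xs-unique)
      (λ x∈filter → let x∈xs , px = ∈-filter⁻ (T? ∘ p) x∈filter in true⊆ys x∈xs px)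

  ≤-countTrue : ∀ (p : A → Bool) {xs ys} → Unique ys →
                (∀ {y} → y ∈ ys → y ∈ xs × T (p y)) → length ys ≤ countTrue p xs
  ≤-countTrue p {xs} ys-unique ys⊆true
    rewrite countTrue≡length∘filter p xs =
    unique⊆⇒length≤ ys-unique
      (λ y∈ys → let y∈xs , py = ys⊆true y∈ys in ∈-filter⁺ (T? ∘ p) y∈xs py)

countTrue-mono : ∀ {A : Set} {p q : A → Bool} → (∀ x → T (p x) → T (q x)) → ∀ xs →
                 countTrue p xs ≤ countTrue q xs
countTrue-mono p⇒q [] = z≤n
countTrue-mono {p = p} {q} p⇒q (x ∷ xs) with p x in px | q x in qx
... | true  | true  = s≤s (countTrue-mono p⇒q xs)
... | true  | false = ⊥-elim (subst T qx (p⇒q x (subst T (sym px) _)))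
... | false | true  = ℕ.m≤n⇒m≤1+n (countTrue-mono p⇒q xs)
... | false | false = countTrue-mono p⇒q xs

two-distinct : ∀ {A : Set} {xs : List A} → Unique xs → 2 ≤ length xs →
               ∃[ a ] ∃[ b ] (a ∈ xs × b ∈ xs × a ≢ b)
two-distinct {xs = a ∷ b ∷ _} ((a≢b ∷ _) ∷ _) _ = a , b , here refl , there (here refl) , a≢b
two-distinct {xs = _ ∷ []} _ (s≤s ())

∈-map-∷⇒drop1 : ∀ {A : Set} {xs : List A} {w v} → v ∈ map (_∷ w) xs → drop 1 v ≡ w
∈-map-∷⇒drop1 v∈ with _ , _ , refl ← ∈-map⁻ _ v∈ = refl

module _ {A B : Set} (f : A → List B) where

  ∈-concatMap⁺′ : ∀ {xs x y} → x ∈ xs → y ∈ f x → y ∈ concatMap f xs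
  ∈-concatMap⁺′ x∈xs y∈fx = ∈-concatMap⁺ f (lose x∈xs y∈fx)

  ∈-concatMap⁻′ : ∀ xs {y} → y ∈ concatMap f xs → ∃[ x ] (x ∈ xs × y ∈ f x)
  ∈-concatMap⁻′ xs y∈ = find (∈-concatMap⁻ f y∈)

  concatMap-unique : (g : B → A) → (∀ {x y} → y ∈ f x → g y ≡ x) →
                     (∀ x → Unique (f x)) → ∀ {xs} → Unique xs → Unique (concatMap f xs)
  concatMap-unique g g∘f≡id f-unique {[]} [] = []
  concatMap-unique g g∘f≡id f-unique {x ∷ xs} (x∉xs ∷ xs-unique) =
    Unique.++⁺ (f-unique x) (concatMap-unique g g∘f≡id f-unique xs-unique) disjoint
    where
    disjoint : ∀ {y} → ¬ (y ∈ f x × y ∈ concatMap f xs)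
    disjoint (y∈fx , y∈rest) with ∈-concatMap⁻′ xs y∈rest
    ... | x′ , x′∈xs , y∈fx′ =
      All.lookup x∉xs x′∈xs (trans (sym (g∘f≡id y∈fx)) (g∘f≡id y∈fx′))

  length-concatMap : ∀ {c} → (∀ x → length (f x) ≡ c) → ∀ xs →
                     length (concatMap f xs) ≡ length xs * c
  length-concatMap |f|≡c [] = refl
  length-concatMap {c} |f|≡c (x ∷ xs) = begin
    length (f x ++ concatMap f xs)         ≡⟨ length-++ (f x) ⟩
    length (f x) + length (concatMap f xs) ≡⟨ cong₂ _+_ (|f|≡c x) (length-concatMap |f|≡c xs) ⟩
    c + length xs * c                      ∎
    where open ≡-Reasoning

  length-concatMap-≥ : ∀ {c} xs → (∀ {x} → x ∈ xs → c ≤ length (f x)) →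
                       length xs * c ≤ length (concatMap f xs)
  length-concatMap-≥ [] _ = z≤n
  length-concatMap-≥ (x ∷ xs) c≤|f| = ℕ.≤-trans
    (ℕ.+-mono-≤ (c≤|f| (here refl)) (length-concatMap-≥ xs (c≤|f| ∘ there)))
    (ℕ.≤-reflexive (sym (length-++ (f x))))

length-allFin : ∀ n → length (allFin n) ≡ n
length-allFin n = length-tabulate {n = n} id

module _ {C : ℕ} where

  ∈-wordsOfLength⁻ : ∀ r {w : Word C} → w ∈ wordsOfLength C r → length w ≡ r
  ∈-wordsOfLength⁻ zero (here refl) = refl
  ∈-wordsOfLength⁻ (suc r) w∈ with ∈-concatMap⁻′ _ (wordsOfLength C r) w∈
  ... | w′ , w′∈ , w∈children with ∈-map⁻ (_∷ w′) w∈children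
  ... | _ , _ , refl = cong suc (∈-wordsOfLength⁻ r w′∈)

  ∈-wordsOfLength⁺ : ∀ (w : Word C) → w ∈ wordsOfLength C (length w)
  ∈-wordsOfLength⁺ [] = here refl
  ∈-wordsOfLength⁺ (b ∷ w) =
    ∈-concatMap⁺′ _ (∈-wordsOfLength⁺ w) (∈-map⁺ (_∷ w) (∈-allFin b))

  wordsOfLength-unique : ∀ r → Unique (wordsOfLength C r)
  wordsOfLength-unique zero = [] ∷ []
  wordsOfLength-unique (suc r) =
    concatMap-unique _ (drop 1) ∈-map-∷⇒drop1
      (λ _ → Unique.map⁺ ∷-injectiveˡ (Unique.allFin⁺ C)) (wordsOfLength-unique r)

  length-wordsOfLength : ∀ r → length (wordsOfLength C r) ≡ C ^ r
  length-wordsOfLength zero = refl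
  length-wordsOfLength (suc r) = begin
    length (wordsOfLength C (suc r)) ≡⟨ length-concatMap _ |children|≡C (wordsOfLength C r) ⟩
    length (wordsOfLength C r) * C   ≡⟨ cong (_* C) (length-wordsOfLength r) ⟩
    C ^ r * C                        ≡⟨ ℕ.*-comm (C ^ r) C ⟩
    C ^ suc r                        ∎
    where
    open ≡-Reasoning
    |children|≡C : ∀ (w : Word C) → length (map (_∷ w) (allFin C)) ≡ C
    |children|≡C w = trans (length-map _ (allFin C)) (length-allFin C)

  ∈-vertices⁻ : ∀ L {w : Word C} → w ∈ vertices C L → length w ≤ L
  ∈-vertices⁻ L w∈ with ∈-concatMap⁻′ (wordsOfLength C) (upTo (suc L)) w∈
  ... | r , r∈ , w∈r rewrite ∈-wordsOfLength⁻ r w∈r = ℕ.s≤s⁻¹ (∈-upTo⁻ r∈)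

  ∈-vertices⁺ : ∀ L {w : Word C} → length w ≤ L → w ∈ vertices C L
  ∈-vertices⁺ L {w} |w|≤L =
    ∈-concatMap⁺′ (wordsOfLength C) (∈-upTo⁺ (s≤s |w|≤L)) (∈-wordsOfLength⁺ w)

  vertices-unique : ∀ L → Unique (vertices C L)
  vertices-unique L = concatMap-unique (wordsOfLength C) length (∈-wordsOfLength⁻ _)
                        wordsOfLength-unique (Unique.upTo⁺ (suc L))

data Exchange {C : ℕ} : Word C → Word C → Set where
  exchange : ∀ {c d} n rest → c ≢ d →
             Exchange (replicate (suc n) c ++ d ∷ rest) (replicate (suc n) d ++ c ∷ rest)

module _ {C : ℕ} where

  rule2-go-run : ∀ {c d : Fin C} {rest} → c ≢ d → ∀ j n →
                 rule2-go c j (replicate n c ++ d ∷ rest) ≡ just (replicate (j + n) d ++ c ∷ rest)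
  rule2-go-run c≢d j zero rewrite =ᶠ-≢ (≢-sym c≢d) | ℕ.+-identityʳ j = refl
  rule2-go-run {c} c≢d j (suc n) rewrite =ᶠ-refl c | ℕ.+-suc j n = rule2-go-run c≢d (suc j) n

  rule2-exchange : ∀ {v w : Word C} → Exchange v w → rule2 v ≡ just w
  rule2-exchange (exchange n _ c≢d) = rule2-go-run c≢d 1 n

  replicate-∷ʳ : ∀ n (c : Fin C) xs → replicate n c ++ c ∷ xs ≡ replicate (suc n) c ++ xs
  replicate-∷ʳ zero c xs = refl
  replicate-∷ʳ (suc n) c xs = cong (c ∷_) (replicate-∷ʳ n c xs)

  rule2-go-exchange : ∀ {c : Fin C} {w : Word C} j xs → rule2-go c (suc j) xs ≡ just w →
                      Exchange (replicate (suc j) c ++ xs) w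
  rule2-go-exchange {c} {w} j (d ∷ rest) eq with d =ᶠ c in d=c
  ... | true with refl ← toWitness (subst T (sym d=c) _)
    = subst (λ v → Exchange v w) (sym (replicate-∷ʳ (suc j) c rest))
        (rule2-go-exchange (suc j) rest eq)
  rule2-go-exchange {c} j (d ∷ rest) refl | false =
    exchange j rest (λ { refl → subst T d=c (fromWitness refl) })

  exchange-rule2 : ∀ {v w : Word C} → rule2 v ≡ just w → Exchange v w
  exchange-rule2 {c ∷ xs} = rule2-go-exchange 0 xs

  Exchange-sym : ∀ {v w : Word C} → Exchange v w → Exchange w v
  Exchange-sym (exchange n rest c≢d) = exchange n rest (≢-sym c≢d)

  Exchange-functional : ∀ {v w w′ : Word C} → Exchange v w → Exchange v w′ → w ≡ w′
  Exchange-functional e e′ = just-injective (trans (sym (rule2-exchange e)) (rule2-exchange e′))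

  Exchange-length : ∀ {v w : Word C} → Exchange v w → length w ≡ length v
  Exchange-length (exchange {c} {d} n rest _) = trans (|run| d c) (sym (|run| c d))
    where
    |run| : ∀ x y → length (replicate (suc n) x ++ y ∷ rest) ≡ suc n + suc (length rest)
    |run| x y = trans (length-++ (replicate (suc n) x))
                      (cong (_+ suc (length rest)) (length-replicate (suc n)))

infix 4 _∈N[_]

data _∈N[_] {C : ℕ} : Word C → Word C → Set where
  self      : ∀ {v} → v ∈N[ v ]
  sibling   : ∀ x y t → (y ∷ t) ∈N[ x ∷ t ]
  exchanged : ∀ {v w} → Exchange v w → w ∈N[ v ]
  parent    : ∀ x t → t ∈N[ x ∷ t ]
  child     : ∀ x v → (x ∷ v) ∈N[ v ]

module _ {C : ℕ} where

  ==-sound : ∀ {u v : Word C} → T (u == v) → u ≡ v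
  ==-sound {u} {v} = toWitness {a? = ≡-dec _≟_ u v}

  ==-refl : ∀ (u : Word C) → T (u == u)
  ==-refl u = fromWitness {a? = ≡-dec _≟_ u u} refl

  ∈N-sym : ∀ {v w : Word C} → w ∈N[ v ] → v ∈N[ w ]
  ∈N-sym self = self
  ∈N-sym (sibling x y t) = sibling y x t
  ∈N-sym (exchanged e) = exchanged (Exchange-sym e)
  ∈N-sym (parent x t) = child x t
  ∈N-sym (child x v) = parent x v

  private
    self-sound : ∀ {v w : Word C} → T (w == v) → w ∈N[ v ]
    self-sound t with refl ← ==-sound t = self

    sibling-sound : ∀ (v w : Word C) → T (siblingᵇ v w) → w ∈N[ v ]
    sibling-sound (x ∷ t) (y ∷ t′) sib with refl ← ==-sound (proj₂ (T-∧⁻ {not (x =ᶠ y)} sib)) =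
      sibling x y t

    exchange-sound : ∀ {v w : Word C} → T (isJust≡ (rule2 v) w) → Exchange v w
    exchange-sound {v} t with rule2 v in eq
    ... | just w with refl ← ==-sound t = exchange-rule2 eq

    child-sound : ∀ (v w : Word C) → T (parentOf v w) → w ∈N[ v ]
    child-sound v (x ∷ w) t with refl ← ==-sound t = child x v

  private
    NbhdCases : Word C → Word C → Set
    NbhdCases v w = T (w == v) ⊎ T (siblingᵇ v w) ⊎ T (isJust≡ (rule2 v) w) ⊎
                    T (isJust≡ (rule2 w) v) ⊎ T (parentOf v w) ⊎ T (parentOf w v)

    closedNbhd⇔ : ∀ v w → T (inClosedNbhd v w) ⇔ NbhdCases v w
    closedNbhd⇔ v w =
      (⇔-id _ ⊎-⇔ (⇔-id _ ⊎-⇔ (⇔-id _ ⊎-⇔ (⇔-id _ ⊎-⇔ T-∨ {parentOf v w})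
                                             ⇔-∘ T-∨ {isJust≡ (rule2 w) v})
                               ⇔-∘ T-∨ {isJust≡ (rule2 v) w})
                 ⇔-∘ T-∨ {siblingᵇ v w})
      ⇔-∘ T-∨ {w == v}

    closedNbhd⁺ : ∀ v w → NbhdCases v w → T (inClosedNbhd v w)
    closedNbhd⁺ v w = Equivalence.from (closedNbhd⇔ v w)

  ∈N-sound : ∀ {v w : Word C} → T (inClosedNbhd v w) → w ∈N[ v ]
  ∈N-sound {v} {w} t with Equivalence.to (closedNbhd⇔ v w) t
  ... | inj₁ w=v = self-sound w=v
  ... | inj₂ (inj₁ sib) = sibling-sound v w sib
  ... | inj₂ (inj₂ (inj₁ r2)) = exchanged (exchange-sound r2)
  ... | inj₂ (inj₂ (inj₂ (inj₁ r2))) = exchanged (Exchange-sym (exchange-sound r2))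
  ... | inj₂ (inj₂ (inj₂ (inj₂ (inj₁ par)))) = child-sound v w par
  ... | inj₂ (inj₂ (inj₂ (inj₂ (inj₂ par)))) = ∈N-sym (child-sound w v par)

  ∈N-complete : ∀ {v w : Word C} → w ∈N[ v ] → T (inClosedNbhd v w)
  ∈N-complete {v} self = closedNbhd⁺ v v (inj₁ (==-refl v))
  ∈N-complete (sibling x y t) = sibling-complete (x ≟ y)
    where
    sibling-complete : Dec (x ≡ y) → T (inClosedNbhd (x ∷ t) (y ∷ t))
    sibling-complete (yes refl) = closedNbhd⁺ (x ∷ t) (x ∷ t) (inj₁ (==-refl (x ∷ t)))
    sibling-complete (no x≢y) =
      closedNbhd⁺ (x ∷ t) (y ∷ t) (inj₂ (inj₁ (T-∧⁺ (fromWitnessFalse x≢y) (==-refl t))))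
  ∈N-complete {v} {w} (exchanged e) = closedNbhd⁺ v w (inj₂ (inj₂ (inj₁ r2)))
    where
    r2 : T (isJust≡ (rule2 v) w)
    r2 = subst (λ m → T (isJust≡ m w)) (sym (rule2-exchange e)) (==-refl w)
  ∈N-complete (parent x t) =
    closedNbhd⁺ (x ∷ t) t (inj₂ (inj₂ (inj₂ (inj₂ (inj₂ (==-refl t))))))
  ∈N-complete (child x v) =
    closedNbhd⁺ v (x ∷ v) (inj₂ (inj₂ (inj₂ (inj₂ (inj₁ (==-refl v))))))

  ∈N-level : ∀ {v w : Word C} → w ∈N[ v ] →
             length w ≡ length v ⊎ (∃[ x ] v ≡ x ∷ w) ⊎ (∃[ x ] w ≡ x ∷ v)
  ∈N-level self = inj₁ refl
  ∈N-level (sibling _ _ _) = inj₁ refl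
  ∈N-level (exchanged e) = inj₁ (Exchange-length e)
  ∈N-level (parent x _) = inj₂ (inj₁ (x , refl))
  ∈N-level (child x _) = inj₂ (inj₂ (x , refl))

  ∈N-leaf : ∀ {x t} {w : Word C} → w ∈N[ x ∷ t ] → length w ≤ length (x ∷ t) →
            (∃[ y ] w ≡ y ∷ t) ⊎ Exchange (x ∷ t) w ⊎ w ≡ t
  ∈N-leaf {x} self _ = inj₁ (x , refl)
  ∈N-leaf (sibling _ y _) _ = inj₁ (y , refl)
  ∈N-leaf (exchanged e) _ = inj₂ (inj₁ e)
  ∈N-leaf (parent _ _) _ = inj₂ (inj₂ refl)
  ∈N-leaf (child _ _) |w|≤ = contradiction |w|≤ ℕ.1+n≰n

-- Propagation

module Propagation (C L k : ℕ) (S : List (Word C)) (S⊆V : All (_∈ vertices C L) S) where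

  -- A record rather than T (P …) so that unification can recover i and u.
  record Observed (i : ℕ) (u : Word C) : Set where
    constructor observed
    field holds : T (P C L k S i u)
  open Observed public

  unobservedNbr : ℕ → Word C → Word C → Bool
  unobservedNbr i v w = inClosedNbhd v w ∧ not (P C L k S i w)

  unobserved : ℕ → Word C → ℕ
  unobserved i v = countTrue (unobservedNbr i v) (vertices C L)

  unobservedNbr⁺ : ∀ {i v w} → w ∈N[ v ] → ¬ Observed i w → T (unobservedNbr i v w)
  unobservedNbr⁺ {v = v} {w} w∈N unobs =
    T-∧⁺ {inClosedNbhd v w} (∈N-complete w∈N) (T-not⁺ (unobs ∘ observed))

  unobservedNbr⁻ : ∀ {i v w} → T (unobservedNbr i v w) → w ∈N[ v ] × ¬ Observed i w
  unobservedNbr⁻ {v = v} {w} t = let w∈N , unobs = T-∧⁻ {inClosedNbhd v w} t in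
    ∈N-sound w∈N , T-not⁻ unobs ∘ holds

  observed-zero⁺ : ∀ {s u} → s ∈ S → u ∈N[ s ] → Observed 0 u
  observed-zero⁺ s∈S u∈N = observed (any⁺ _ (lose s∈S (∈N-complete u∈N)))

  observed-zero⁻ : ∀ {u} → Observed 0 u → ∃[ s ] (s ∈ S × u ∈N[ s ])
  observed-zero⁻ (observed obs) with s , s∈S , u∈N ← find (any⁻ _ S obs) =
    s , s∈S , ∈N-sound u∈N

  observed-suc⁺ : ∀ {i v u} → v ∈ vertices C L → Observed i v → unobserved i v ≤ k →
                  u ∈N[ v ] → Observed (suc i) u
  observed-suc⁺ v∈V (observed obs) few u∈N =
    observed (any⁺ _ (lose v∈V (T-∧⁺ obs (T-∧⁺ (ℕ.≤⇒≤ᵇ few) (∈N-complete u∈N)))))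

  observed-suc⁻ : ∀ {i u} → Observed (suc i) u →
                  ∃[ v ] (v ∈ vertices C L × Observed i v × unobserved i v ≤ k × u ∈N[ v ])
  observed-suc⁻ {i} (observed obs) with v , v∈V , t ← find (any⁻ _ (vertices C L) obs) =
    let obs , t = T-∧⁻ t ; few , u∈N = T-∧⁻ t in
    v , v∈V , observed obs , ℕ.≤ᵇ⇒≤ (unobserved i v) k few , ∈N-sound u∈N

  unobserved-≤ : ∀ {i v} (zs : List (Word C)) →
                 (∀ w → length w ≤ L → w ∈N[ v ] → Observed i w ⊎ w ∈ zs) →
                 unobserved i v ≤ length zs
  unobserved-≤ {i} {v} zs cover =
    countTrue-≤ _≟ʷ_ (unobservedNbr i v) {ys = zs} (vertices-unique L) λ {w} w∈V t →
      let w∈N , unobs = unobservedNbr⁻ t in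
      [ (λ obs → contradiction obs unobs) , id ] (cover w (∈-vertices⁻ L w∈V) w∈N)

  unobserved-≥ : ∀ {i v ws} → Unique ws →
                 (∀ {w} → w ∈ ws → length w ≤ L × w ∈N[ v ] × ¬ Observed i w) →
                 length ws ≤ unobserved i v
  unobserved-≥ {i} {v} ws-unique ws-unobserved =
    ≤-countTrue _≟ʷ_ (unobservedNbr i v) ws-unique λ w∈ws →
      let |w|≤L , w∈N , unobs = ws-unobserved w∈ws in
      ∈-vertices⁺ L |w|≤L , unobservedNbr⁺ w∈N unobs

  propagate : ∀ {i v} → v ∈ vertices C L → Observed i v → (zs : List (Word C)) → length zs ≤ k →
              (∀ w → length w ≤ L → w ∈N[ v ] → Observed i w ⊎ w ∈ zs) →
              ∀ {u} → u ∈N[ v ] → Observed (suc i) u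
  propagate v∈V obs zs |zs|≤k cover =
    observed-suc⁺ v∈V obs (ℕ.≤-trans (unobserved-≤ zs cover) |zs|≤k)

  observed-suc : ∀ {i u} → Observed i u → Observed (suc i) u
  observed-suc {zero} obs with s , s∈S , u∈N ← observed-zero⁻ obs =
    propagate (All.lookup S⊆V s∈S) (observed-zero⁺ s∈S self) [] z≤n
      (λ w _ w∈N → inj₁ (observed-zero⁺ s∈S w∈N)) u∈N
  observed-suc {suc i} obs with v , v∈V , v-obs , few , u∈N ← observed-suc⁻ obs =
    observed-suc⁺ v∈V (observed-suc v-obs) (ℕ.≤-trans fewer few) u∈N
    where
    fewer : unobserved (suc i) v ≤ unobserved i v
    fewer = countTrue-mono (λ w t → let w∈N , unobs = unobservedNbr⁻ {suc i} {v} {w} t in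
                             unobservedNbr⁺ {i} w∈N (unobs ∘ observed-suc))
                           (vertices C L)

  observed-mono : ∀ {i j u} → i ≤ j → Observed i u → Observed j u
  observed-mono = go ∘ ℕ.≤⇒≤′
    where
    go : ∀ {i j u} → i ≤′ j → Observed i u → Observed j u
    go ℕ.≤′-refl obs = obs
    go {j = suc j} (ℕ.≤′-step i≤′j) obs = observed-suc {j} (go i≤′j obs)

-- Lower bound

module LowerBound (C m k : ℕ) (S : List (Word C)) (S⊆V : All (_∈ vertices C (2 + m)) S) where

  open Propagation C (2 + m) k S S⊆V
  open import Data.List.Membership.DecPropositional (_≟ʷ_ {C}) using (_∈?_)

  collapse : Word C → Word C
  collapse t with length t ℕ.≟ 2 + m
  ... | yes _ = drop 1 t
  ... | no _ = t

  collapse-leaf : ∀ {x} {w : Word C} → length (x ∷ w) ≡ 2 + m → collapse (x ∷ w) ≡ w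
  collapse-leaf {x} {w} |xw| with length (x ∷ w) ℕ.≟ 2 + m
  ... | yes _ = refl
  ... | no |xw|≢ = contradiction |xw| |xw|≢

  collapse-inner : ∀ {w : Word C} → length w ≢ 2 + m → collapse w ≡ w
  collapse-inner {w} |w|≢ with length w ℕ.≟ 2 + m
  ... | yes |w|≡ = contradiction |w|≡ |w|≢
  ... | no _ = refl

  Hit : Word C → Set
  Hit w = w ∈ map collapse S

  module _ (q : Word C) (|q| : length q ≡ m) (ds : List (Fin C)) (ds-unique : Unique ds)
           (ds-large : 2 + k ≤ length ds) (ds-unhit : ∀ {a} → a ∈ ds → ¬ Hit (a ∷ q)) where

    private
      |leaf| : ∀ (x y : Fin C) → length (x ∷ y ∷ q) ≡ 2 + m
      |leaf| _ _ = cong (suc ∘ suc) |q|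

      below-leaf : ∀ {x y : Fin C} {w} → w ∈ vertices C (2 + m) → length w ≤ length (x ∷ y ∷ q)
      below-leaf {x} {y} {w} w∈V =
        subst (length w ≤_) (sym (|leaf| x y)) (∈-vertices⁻ (2 + m) w∈V)

      hit-by-leaf : ∀ {s x a} → s ∈ S → s ≡ x ∷ a ∷ q → Hit (a ∷ q)
      hit-by-leaf {x = x} {a} s∈S refl =
        subst (_∈ map collapse S) (collapse-leaf (|leaf| x a)) (∈-map⁺ collapse s∈S)

      hit-by-self : ∀ {a} → a ∷ q ∈ S → Hit (a ∷ q)
      hit-by-self {a} a∷q∈S =
        subst (_∈ map collapse S) (collapse-inner |inner|≢) (∈-map⁺ collapse a∷q∈S)
        where
        |inner|≢ : length (a ∷ q) ≢ 2 + m
        |inner|≢ eq = ℕ.1+n≢n (trans (sym eq) (cong suc |q|))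

    too-many-unobserved :
      ∀ {i a v} → (∀ {a b} → a ∈ ds → b ∈ ds → a ≢ b → ¬ Observed i (b ∷ a ∷ q)) →
      a ∈ ds → (∀ c → (c ∷ a ∷ q) ∈N[ v ]) → k < unobserved i v
    too-many-unobserved {i} {a} {v} leaves-unobserved a∈ children∈N =
      ℕ.<-≤-trans k<|ws| (unobserved-≥ ws-unique ws-unobserved)
      where
      others : List (Fin C)
      others = filter (¬? ∘ (_≟ a)) ds

      ws : List (Word C)
      ws = map (_∷ a ∷ q) others

      ws-unique : Unique ws
      ws-unique = Unique.map⁺ ∷-injectiveˡ (Unique.filter⁺ (¬? ∘ (_≟ a)) ds-unique)

      ds⊆ : ∀ {c} → c ∈ ds → c ∈ a ∷ others
      ds⊆ {c} c∈ with c ≟ a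
      ... | yes refl = here refl
      ... | no c≢a = there (∈-filter⁺ (¬? ∘ (_≟ a)) c∈ c≢a)

      k<|ws| : k < length ws
      k<|ws| = subst (k <_) (sym (length-map _ others))
                 (ℕ.s≤s⁻¹ (ℕ.≤-trans ds-large (unique⊆⇒length≤ _≟_ ds-unique ds⊆)))

      ws-unobserved : ∀ {w} → w ∈ ws → length w ≤ 2 + m × w ∈N[ v ] × ¬ Observed i w
      ws-unobserved w∈ with c , c∈others , refl ← ∈-map⁻ _ w∈ =
        let c∈ , c≢a = ∈-filter⁻ (¬? ∘ (_≟ a)) c∈others in
        ℕ.≤-reflexive (|leaf| c a) , children∈N c , leaves-unobserved a∈ c∈ (≢-sym c≢a)

    fort-unobserved : ∀ i {a b} → a ∈ ds → b ∈ ds → a ≢ b → ¬ Observed i (b ∷ a ∷ q)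
    fort-unobserved zero {a} {b} a∈ b∈ a≢b obs
      with s , s∈S , leaf∈N ← observed-zero⁻ obs
      with ∈N-leaf (∈N-sym leaf∈N) (below-leaf {b} {a} (All.lookup S⊆V s∈S))
    ... | inj₁ (_ , s≡) = ds-unhit a∈ (hit-by-leaf s∈S s≡)
    ... | inj₂ (inj₁ e) =
      ds-unhit b∈ (hit-by-leaf s∈S (Exchange-functional e (exchange 0 q (≢-sym a≢b))))
    ... | inj₂ (inj₂ refl) = ds-unhit a∈ (hit-by-self s∈S)
    fort-unobserved (suc i) {a} {b} a∈ b∈ a≢b obs
      with v , v∈V , v-obs , few , leaf∈N ← observed-suc⁻ obs
      with ∈N-leaf (∈N-sym leaf∈N) (below-leaf {b} {a} v∈V)
    ... | inj₁ (y , refl) =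
      ℕ.<⇒≱ (too-many-unobserved (fort-unobserved i) a∈ (λ c → sibling y c _)) few
    ... | inj₂ (inj₁ e) =
      fort-unobserved i b∈ a∈ (≢-sym a≢b)
        (subst (Observed i) (Exchange-functional e (exchange 0 q (≢-sym a≢b))) v-obs)
    ... | inj₂ (inj₂ refl) =
      ℕ.<⇒≱ (too-many-unobserved (fort-unobserved i) a∈ (λ c → child c _)) few

  hit? : ∀ q (a : Fin C) → Dec (Hit (a ∷ q))
  hit? q a = (a ∷ q) ∈? map collapse S

  hitChildren : Word C → List (Fin C)
  hitChildren q = filter (hit? q) (allFin C)

  unhit? : ∀ q (a : Fin C) → Dec (¬ Hit (a ∷ q))
  unhit? q a = ¬? (hit? q a)

  unhitChildren : Word C → List (Fin C)
  unhitChildren q = filter (unhit? q) (allFin C)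

  children-split : ∀ q → C ≤ length (hitChildren q) + length (unhitChildren q)
  children-split q = begin
    C                                         ≡⟨ length-allFin C ⟨
    length (allFin C)                         ≤⟨ unique⊆⇒length≤ _≟_ (Unique.allFin⁺ C) split ⟩
    length (hitChildren q ++ unhitChildren q) ≡⟨ length-++ (hitChildren q) ⟩
    length (hitChildren q) + length (unhitChildren q) ∎
    where
    open ℕ.≤-Reasoning

    split : ∀ {a} → a ∈ allFin C → a ∈ hitChildren q ++ unhitChildren q
    split {a} a∈ with hit? q a
    ... | yes hit = ∈-++⁺ˡ (∈-filter⁺ (hit? q) a∈ hit)
    ... | no unhit = ∈-++⁺ʳ (hitChildren q) (∈-filter⁺ (unhit? q) a∈ unhit)

  many-children-hit : ∀ {i s q} → (∀ {v} → v ∈ vertices C (2 + m) → Observed i v) →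
                      s + suc k ≤ C → length q ≡ m → s ≤ length (hitChildren q)
  many-children-hit {i} {s} {q} all-observed s+k<C |q| with s ℕ.≤? length (hitChildren q)
  ... | yes enough = enough
  ... | no few =
    let a , b , a∈ , b∈ , a≢b =
          two-distinct unhit-unique (ℕ.≤-trans (ℕ.m≤m+n 2 k) 2+k≤|unhit|) in
    contradiction (all-observed (∈-vertices⁺ (2 + m) (ℕ.≤-reflexive (cong (suc ∘ suc) |q|))))
      (fort-unobserved q |q| (unhitChildren q) unhit-unique 2+k≤|unhit| unhit i a∈ b∈ a≢b)
    where
    unhit-unique : Unique (unhitChildren q)
    unhit-unique = Unique.filter⁺ (unhit? q) (Unique.allFin⁺ C)

    unhit : ∀ {a} → a ∈ unhitChildren q → ¬ Hit (a ∷ q)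
    unhit = proj₂ ∘ ∈-filter⁻ (unhit? q) {xs = allFin C}

    2+k≤|unhit| : 2 + k ≤ length (unhitChildren q)
    2+k≤|unhit| = ℕ.+-cancelˡ-≤ (length (hitChildren q)) (2 + k) (length (unhitChildren q)) (begin
      length (hitChildren q) + suc (suc k) ≡⟨ ℕ.+-suc (length (hitChildren q)) (suc k) ⟩
      suc (length (hitChildren q)) + suc k ≤⟨ ℕ.+-monoˡ-≤ (suc k) (ℕ.≰⇒> few) ⟩
      s + suc k                            ≤⟨ s+k<C ⟩
      C                                    ≤⟨ children-split q ⟩
      length (hitChildren q) + length (unhitChildren q) ∎)
      where open ℕ.≤-Reasoning

  kPDS-size-≥ : ∀ {s} → s + suc k ≤ C →
                (∃[ i ] ∀ v → v ∈ vertices C (2 + m) → P C (2 + m) k S i v ≡ true) →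
                s * C ^ m ≤ length S
  kPDS-size-≥ {s} s+k<C (i , all-true) = begin
    s * C ^ m                      ≡⟨ ℕ.*-comm s (C ^ m) ⟩
    C ^ m * s                      ≡⟨ cong (_* s) (length-wordsOfLength m) ⟨
    length (wordsOfLength C m) * s ≤⟨ length-concatMap-≥ block (wordsOfLength C m) block-large ⟩
    length hits                    ≤⟨ unique⊆⇒length≤ _≟ʷ_ hits-unique hits⊆ ⟩
    length (map collapse S)        ≡⟨ length-map collapse S ⟩
    length S                       ∎
    where
    open ℕ.≤-Reasoning
    block : Word C → List (Word C)
    block q = map (_∷ q) (hitChildren q)

    hits : List (Word C)
    hits = concatMap block (wordsOfLength C m)

    block-large : ∀ {q} → q ∈ wordsOfLength C m → s ≤ length (block q)
    block-large {q} q∈ = subst (s ≤_) (sym (length-map _ (hitChildren q)))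
      (many-children-hit all-observed s+k<C (∈-wordsOfLength⁻ m q∈))
      where
      all-observed : ∀ {v} → v ∈ vertices C (2 + m) → Observed i v
      all-observed {v} v∈ = observed (Equivalence.from T-≡ (all-true v v∈))

    hits-unique : Unique hits
    hits-unique = concatMap-unique block (drop 1) ∈-map-∷⇒drop1
      (λ q → Unique.map⁺ ∷-injectiveˡ (Unique.filter⁺ (hit? q) (Unique.allFin⁺ C)))
      (wordsOfLength-unique m)

    hits⊆ : ∀ {w} → w ∈ hits → w ∈ map collapse S
    hits⊆ w∈ with q , _ , w∈block ← ∈-concatMap⁻′ block (wordsOfLength C m) w∈
                with a , a∈ , refl ← ∈-map⁻ _ w∈block =
      proj₂ (∈-filter⁻ (hit? q) {xs = allFin C} a∈)

-- Cyclic digits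

[m%d+n]%d≡[m+n]%d : ∀ m n d .{{_ : NonZero d}} → (m % d + n) % d ≡ (m + n) % d
[m%d+n]%d≡[m+n]%d m n d = begin
  (m % d + n) % d         ≡⟨ %-distribˡ-+ (m % d) n d ⟩
  (m % d % d + n % d) % d ≡⟨ cong (λ x → (x + n % d) % d) (m%n%n≡m%n m d) ⟩
  (m % d + n % d) % d     ≡⟨ %-distribˡ-+ m n d ⟨
  (m + n) % d             ∎
  where open ≡-Reasoning

[m+n%d]%d≡[m+n]%d : ∀ m n d .{{_ : NonZero d}} → (m + n % d) % d ≡ (m + n) % d
[m+n%d]%d≡[m+n]%d m n d = begin
  (m + n % d) % d ≡⟨ cong (_% d) (ℕ.+-comm m (n % d)) ⟩
  (n % d + m) % d ≡⟨ [m%d+n]%d≡[m+n]%d n m d ⟩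
  (n + m) % d     ≡⟨ cong (_% d) (ℕ.+-comm n m) ⟩
  (m + n) % d     ∎
  where open ≡-Reasoning

module Cyclic (C : ℕ) .{{_ : NonZero C}} where

  infixl 6 _⊕_

  _⊕_ : Fin C → ℕ → Fin C
  r ⊕ j = (toℕ r + j) mod C

  toℕ-⊕ : ∀ r j → toℕ (r ⊕ j) ≡ (toℕ r + j) % C
  toℕ-⊕ r j = toℕ-fromℕ< (m%n<n (toℕ r + j) C)

  toℕ%C : ∀ (r : Fin C) → toℕ r % C ≡ toℕ r
  toℕ%C r = m<n⇒m%n≡m (toℕ<n r)

  ⊕-+ : ∀ r i j → r ⊕ i ⊕ j ≡ r ⊕ (i + j)
  ⊕-+ r i j = toℕ-injective (begin
    toℕ (r ⊕ i ⊕ j)             ≡⟨ toℕ-⊕ (r ⊕ i) j ⟩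
    (toℕ (r ⊕ i) + j) % C       ≡⟨ cong (λ x → (x + j) % C) (toℕ-⊕ r i) ⟩
    ((toℕ r + i) % C + j) % C   ≡⟨ [m%d+n]%d≡[m+n]%d (toℕ r + i) j C ⟩
    (toℕ r + i + j) % C         ≡⟨ cong (_% C) (ℕ.+-assoc (toℕ r) i j) ⟩
    (toℕ r + (i + j)) % C       ≡⟨ toℕ-⊕ r (i + j) ⟨
    toℕ (r ⊕ (i + j))           ∎)
    where open ≡-Reasoning

  ⊕-zero : ∀ r → r ⊕ 0 ≡ r
  ⊕-zero r = toℕ-injective (begin
    toℕ (r ⊕ 0)     ≡⟨ toℕ-⊕ r 0 ⟩
    (toℕ r + 0) % C ≡⟨ cong (_% C) (ℕ.+-identityʳ (toℕ r)) ⟩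
    toℕ r % C       ≡⟨ toℕ%C r ⟩
    toℕ r           ∎)
    where open ≡-Reasoning

  ⊕-C : ∀ r → r ⊕ C ≡ r
  ⊕-C r = toℕ-injective (begin
    toℕ (r ⊕ C)     ≡⟨ toℕ-⊕ r C ⟩
    (toℕ r + C) % C ≡⟨ %-remove-+ʳ (toℕ r) ∣-refl ⟩
    toℕ r % C       ≡⟨ toℕ%C r ⟩
    toℕ r           ∎)
    where open ≡-Reasoning

  offset : Fin C → Fin C → ℕ
  offset r x = (C ∸ toℕ r + toℕ x) % C

  offset<C : ∀ r x → offset r x < C
  offset<C r x = m%n<n (C ∸ toℕ r + toℕ x) C

  ⊕-offset : ∀ r x → r ⊕ offset r x ≡ x
  ⊕-offset r x = toℕ-injective (begin
    toℕ (r ⊕ offset r x)          ≡⟨ toℕ-⊕ r (offset r x) ⟩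
    (ρ + (C ∸ ρ + ξ) % C) % C     ≡⟨ [m+n%d]%d≡[m+n]%d ρ (C ∸ ρ + ξ) C ⟩
    (ρ + (C ∸ ρ + ξ)) % C         ≡⟨ cong (_% C) (ℕ.+-assoc ρ (C ∸ ρ) ξ) ⟨
    (ρ + (C ∸ ρ) + ξ) % C         ≡⟨ cong (λ y → (y + ξ) % C) (ℕ.m+[n∸m]≡n ρ≤C) ⟩
    (C + ξ) % C                   ≡⟨ %-remove-+ˡ ξ ∣-refl ⟩
    ξ % C                         ≡⟨ toℕ%C x ⟩
    ξ                             ∎)
    where
    open ≡-Reasoning
    ρ = toℕ r
    ξ = toℕ x
    ρ≤C = ℕ.<⇒≤ (toℕ<n r)

  offset-⊕ : ∀ r {j} → j < C → offset r (r ⊕ j) ≡ j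
  offset-⊕ r {j} j<C = begin
    (C ∸ ρ + toℕ (r ⊕ j)) % C     ≡⟨ cong (λ y → (C ∸ ρ + y) % C) (toℕ-⊕ r j) ⟩
    (C ∸ ρ + (ρ + j) % C) % C     ≡⟨ [m+n%d]%d≡[m+n]%d (C ∸ ρ) (ρ + j) C ⟩
    (C ∸ ρ + (ρ + j)) % C         ≡⟨ cong (_% C) (ℕ.+-assoc (C ∸ ρ) ρ j) ⟨
    (C ∸ ρ + ρ + j) % C           ≡⟨ cong (λ y → (y + j) % C) (ℕ.m∸n+n≡m ρ≤C) ⟩
    (C + j) % C                   ≡⟨ %-remove-+ˡ j ∣-refl ⟩
    j % C                         ≡⟨ m<n⇒m%n≡m j<C ⟩
    j                             ∎
    where
    open ≡-Reasoning
    ρ = toℕ r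
    ρ≤C = ℕ.<⇒≤ (toℕ<n r)

-- Upper bound

module UpperBound (s k n : ℕ) (0<s : 0 < s) (0<k : 0 < k) where

  C : ℕ
  C = suc (s + k)

  L : ℕ
  L = 3 + n

  open Cyclic C

  -- Relative to r, the offsets 1 … s form A r, offset s+k (i.e. −1) is prev r, and the
  -- remaining k offsets 0, s+1, …, s+k−1 form Z r.
  prev : Fin C → Fin C
  prev r = r ⊕ (s + k)

  A : Fin C → List (Fin C)
  A r = applyUpTo (λ i → r ⊕ suc i) s

  Z : Fin C → List (Fin C)
  Z r = r ∷ applyUpTo (λ i → r ⊕ (suc s + i)) (pred k)

  suc-pred-k : suc (pred k) ≡ k
  suc-pred-k = ℕ.suc-pred k {{ℕ.>-nonZero 0<k}}

  suc[s+pred-k]≡s+k : suc (s + pred k) ≡ s + k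
  suc[s+pred-k]≡s+k = trans (sym (ℕ.+-suc s (pred k))) (cong (s +_) suc-pred-k)

  length-Z : ∀ r → length (Z r) ≡ k
  length-Z r = trans (cong suc (length-applyUpTo _ (pred k))) suc-pred-k

  ⊕1∈A : ∀ r → r ⊕ 1 ∈ A r
  ⊕1∈A r = ∈-applyUpTo⁺ (λ i → r ⊕ suc i) 0<s

  ∈A-prev : ∀ r → r ∈ A (prev r)
  ∈A-prev r = subst (_∈ A (prev r)) prev⊕1 (⊕1∈A (prev r))
    where
    prev⊕1 : prev r ⊕ 1 ≡ r
    prev⊕1 = trans (⊕-+ r (s + k) 1) (trans (cong (r ⊕_) (ℕ.+-comm (s + k) 1)) (⊕-C r))

  prev≢ : ∀ r → prev r ≢ r
  prev≢ r prev≡r = ℕ.n>0⇒n≢0 0<k (ℕ.m+n≡0⇒n≡0 s (begin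
    s + k             ≡⟨ offset-⊕ r (ℕ.n<1+n (s + k)) ⟨
    offset r (prev r) ≡⟨ cong (offset r) (trans prev≡r (sym (⊕-zero r))) ⟩
    offset r (r ⊕ 0)  ≡⟨ offset-⊕ r (s≤s z≤n) ⟩
    0                 ∎))
    where open ≡-Reasoning

  digit-trichotomy : ∀ r x → x ∈ A r ⊎ x ≡ prev r ⊎ x ∈ Z r
  digit-trichotomy r x = subst (λ y → y ∈ A r ⊎ y ≡ prev r ⊎ y ∈ Z r) (⊕-offset r x)
                           (by-offset (offset r x) (offset<C r x))
    where
    by-offset : ∀ j → j < C → r ⊕ j ∈ A r ⊎ r ⊕ j ≡ prev r ⊎ r ⊕ j ∈ Z r
    by-offset zero _ = inj₂ (inj₂ (here (⊕-zero r)))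
    by-offset (suc j) j<C with j ℕ.<? s
    ... | yes j<s = inj₁ (∈-applyUpTo⁺ (λ i → r ⊕ suc i) j<s)
    ... | no j≮s with d , refl ← ℕ.m≤n⇒∃[o]m+o≡n (ℕ.≮⇒≥ j≮s)
        with ℕ.m<1+n⇒m<n∨m≡n (subst (d <_) (sym suc-pred-k)
                                      (ℕ.+-cancelˡ-< s d k (ℕ.s≤s⁻¹ j<C)))
    ... | inj₁ d<pred-k = inj₂ (inj₂ (there (∈-applyUpTo⁺ (λ i → r ⊕ (suc s + i)) d<pred-k)))
    ... | inj₂ refl = inj₂ (inj₁ (cong (r ⊕_) suc[s+pred-k]≡s+k))

  module Observation
    (S : List (Word C)) (S⊆V : All (_∈ vertices C L) S)
    (A-children∈S : ∀ {r q a} → length q ≡ n → a ∈ A r → a ∷ r ∷ q ∈ S) where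

    open Propagation C L k S S⊆V

    level[L-2]-observed : ∀ {i} w → length w ≡ suc n → Observed i w
    level[L-2]-observed (r ∷ q) |w| = observed-mono z≤n
      (observed-zero⁺ (A-children∈S (ℕ.suc-injective |w|) (⊕1∈A r)) (parent (r ⊕ 1) (r ∷ q)))

    level[L-1]-observed : ∀ {i} w → length w ≡ 2 + n → Observed i w
    level[L-1]-observed (x ∷ r ∷ q) |w| = observed-mono z≤n
      (observed-zero⁺ (A-children∈S (ℕ.suc-injective (ℕ.suc-injective |w|)) (⊕1∈A r))
                      (sibling (r ⊕ 1) x (r ∷ q)))

    below-A-observed : ∀ {i x a r q} → length q ≡ n → a ∈ A r → Observed i (x ∷ a ∷ r ∷ q)
    below-A-observed {x = x} {a} {r} {q} |q| a∈A =
      observed-mono z≤n (observed-zero⁺ (A-children∈S |q| a∈A) (child x (a ∷ r ∷ q)))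

    exchange-forced : ∀ {i x y r q u} → length q ≡ n → Exchange (x ∷ y ∷ r ∷ q) u →
                      (∀ z → Observed i (z ∷ y ∷ r ∷ q)) → Observed (suc i) u
    exchange-forced {i} {x} {y} {r} {q} {u} |q| e siblings-observed =
      propagate (∈-vertices⁺ L (ℕ.≤-reflexive |v|)) (siblings-observed x) (u ∷ []) 0<k cover
        (exchanged e)
      where
      |v| : length (x ∷ y ∷ r ∷ q) ≡ L
      |v| = cong (3 +_) |q|

      cover : ∀ w → length w ≤ L → w ∈N[ x ∷ y ∷ r ∷ q ] → Observed i w ⊎ w ∈ u ∷ []
      cover w |w| w∈N with ∈N-leaf w∈N (subst (length w ≤_) (sym |v|) |w|)
      ... | inj₁ (z , refl) = inj₁ (siblings-observed z)
      ... | inj₂ (inj₁ e′) = inj₂ (here (Exchange-functional e′ e))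
      ... | inj₂ (inj₂ refl) = inj₁ (level[L-1]-observed (y ∷ r ∷ q) (cong (2 +_) |q|))

    children-forced : ∀ {i c r q} → length q ≡ n → (zs : List (Fin C)) → length zs ≤ k →
                      (∀ x → Observed i (x ∷ c ∷ r ∷ q) ⊎ x ∈ zs) →
                      ∀ x → Observed (suc i) (x ∷ c ∷ r ∷ q)
    children-forced {i} {c} {r} {q} |q| zs |zs|≤k children x =
      propagate (∈-vertices⁺ L (ℕ.m≤n⇒m≤1+n (ℕ.≤-reflexive |v|))) (level[L-1]-observed v |v|)
        (map (_∷ v) zs) (subst (_≤ k) (sym (length-map _ zs)) |zs|≤k) cover (child x v)
      where
      v = c ∷ r ∷ q

      |v| : length v ≡ 2 + n
      |v| = cong (2 +_) |q|

      cover : ∀ w → length w ≤ L → w ∈N[ v ] → Observed i w ⊎ w ∈ map (_∷ v) zs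
      cover w _ w∈N with ∈N-level w∈N
      ... | inj₁ |w|≡|v| = inj₁ (level[L-1]-observed w (trans |w|≡|v| |v|))
      ... | inj₂ (inj₁ (_ , refl)) = inj₁ (level[L-2]-observed (r ∷ q) (cong suc |q|))
      ... | inj₂ (inj₂ (y , refl)) = Sum.map₂ (∈-map⁺ (_∷ v)) (children y)

    children-observed : ∀ {i c r q} → length q ≡ n →
                        (∀ {a} → a ∈ A r → Observed i (a ∷ c ∷ r ∷ q)) →
                        Observed i (prev r ∷ c ∷ r ∷ q) →
                        ∀ x → Observed (suc i) (x ∷ c ∷ r ∷ q)
    children-observed {i} {c} {r} {q} |q| A-observed prev-observed =
      children-forced |q| (Z r) (ℕ.≤-reflexive (length-Z r)) classify
      where
      classify : ∀ x → Observed i (x ∷ c ∷ r ∷ q) ⊎ x ∈ Z r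
      classify x with digit-trichotomy r x
      ... | inj₁ x∈A = inj₁ (A-observed x∈A)
      ... | inj₂ (inj₁ refl) = inj₁ prev-observed
      ... | inj₂ (inj₂ x∈Z) = inj₂ x∈Z

    levels-above-observed : ∀ t w → length w ≤ 2 + n → suc n ≤ length w + t → Observed t w
    levels-above-observed zero w |w|≤ |w|≥ with ℕ.m≤n⇒m<n∨m≡n |w|≤
    ... | inj₂ |w|≡ = level[L-1]-observed w |w|≡
    ... | inj₁ |w|< = level[L-2]-observed w
      (ℕ.≤-antisym (ℕ.s≤s⁻¹ |w|<) (subst (suc n ≤_) (ℕ.+-identityʳ _) |w|≥))
    levels-above-observed (suc t) w |w|≤ |w|≥ with suc n ℕ.≤? length w + t
    ... | yes |w|≥′ = observed-suc (levels-above-observed t w |w|≤ |w|≥′)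
    ... | no |w|<′ =
      propagate (∈-vertices⁺ L (ℕ.m≤n⇒m≤1+n |v|≤)) (levels-above-observed t v |v|≤ |v|≥)
        (w ∷ []) 0<k cover (parent Fin.zero w)
      where
      v = Fin.zero ∷ w

      |w|≤n : length w ≤ n
      |w|≤n = ℕ.≤-trans (ℕ.m≤m+n (length w) t) (ℕ.s≤s⁻¹ (ℕ.≰⇒> |w|<′))

      |v|≤ : length v ≤ 2 + n
      |v|≤ = s≤s (ℕ.m≤n⇒m≤1+n |w|≤n)

      |v|≥ : suc n ≤ length v + t
      |v|≥ = subst (suc n ≤_) (ℕ.+-suc (length w) t) |w|≥

      cover : ∀ y → length y ≤ L → y ∈N[ v ] → Observed t y ⊎ y ∈ w ∷ []
      cover y _ y∈N with ∈N-level y∈N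
      ... | inj₁ |y|≡ = inj₁ (levels-above-observed t y (subst (_≤ 2 + n) (sym |y|≡) |v|≤)
                                 (subst (λ ℓ → suc n ≤ ℓ + t) (sym |y|≡) |v|≥))
      ... | inj₂ (inj₁ (_ , refl)) = inj₂ (here refl)
      ... | inj₂ (inj₂ (_ , refl)) =
        inj₁ (levels-above-observed t y (s≤s (s≤s |w|≤n)) (ℕ.m≤n⇒m≤1+n |v|≥))

    A-leaf-observed : ∀ {r q a} → length q ≡ n → a ∈ A r →
                      ∀ c → Observed 1 (a ∷ c ∷ r ∷ q)
    A-leaf-observed {r} {q} {a} |q| a∈A c with c ≟ a
    ... | yes refl = below-A-observed |q| a∈A
    ... | no c≢a = exchange-forced |q| (exchange 0 (r ∷ q) c≢a) (λ _ → below-A-observed |q| a∈A)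

    prev-pair-observed : ∀ {r q} → length q ≡ n → Observed 1 (prev r ∷ prev r ∷ r ∷ q)
    prev-pair-observed {r} {q} |q| =
      exchange-forced |q| (exchange 1 q (≢-sym (prev≢ r))) (λ _ → below-A-observed |q| (∈A-prev r))

    below-prev-observed : ∀ {r q} → length q ≡ n → ∀ x → Observed 2 (x ∷ prev r ∷ r ∷ q)
    below-prev-observed {r} |q| =
      children-observed |q| (λ a∈A → A-leaf-observed |q| a∈A (prev r)) (prev-pair-observed |q|)

    prev-leaf-observed : ∀ {r q} → length q ≡ n → ∀ c → Observed 3 (prev r ∷ c ∷ r ∷ q)
    prev-leaf-observed {r} {q} |q| c with c ≟ prev r
    ... | yes refl = observed-suc (below-prev-observed |q| (prev r))
    ... | no c≢prev = exchange-forced |q| (exchange 0 (r ∷ q) c≢prev) (below-prev-observed |q|)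

    leaf-observed : ∀ {i} w → length w ≡ L → Observed (4 + i) w
    leaf-observed {i} (x ∷ c ∷ r ∷ q) |w| = observed-mono (ℕ.m≤m+n 4 i)
      (children-observed |q| (λ a∈A → observed-mono (s≤s z≤n) (A-leaf-observed |q| a∈A c))
                             (prev-leaf-observed |q| c) x)
      where
      |q| : length q ≡ n
      |q| = ℕ.suc-injective (ℕ.suc-injective (ℕ.suc-injective |w|))

    all-observed : ∀ {w} → w ∈ vertices C L → Observed (4 + suc n) w
    all-observed {w} w∈V with length w ℕ.≟ L
    ... | yes |w|≡L = leaf-observed w |w|≡L
    ... | no |w|≢L = observed-mono (ℕ.m≤n+m (suc n) 4)
      (levels-above-observed (suc n) w (ℕ.s≤s⁻¹ (ℕ.≤∧≢⇒< (∈-vertices⁻ L w∈V) |w|≢L))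
                                       (ℕ.m≤n+m (suc n) (length w)))

    S-isKPDS : isKPDS C L k S
    S-isKPDS = S⊆V , 4 + suc n , λ v v∈V → Equivalence.to T-≡ (holds (all-observed v∈V))

  A-children : Word C → Fin C → List (Word C)
  A-children q r = map (_∷ r ∷ q) (A r)

  A-grandchildren : Word C → List (Word C)
  A-grandchildren q = concatMap (A-children q) (allFin C)

  S : List (Word C)
  S = concatMap A-grandchildren (wordsOfLength C n)

  A-children∈S : ∀ {r q a} → length q ≡ n → a ∈ A r → a ∷ r ∷ q ∈ S
  A-children∈S {r} {q} |q| a∈A =
    ∈-concatMap⁺′ A-grandchildren
      (subst (λ ℓ → q ∈ wordsOfLength C ℓ) |q| (∈-wordsOfLength⁺ q))
      (∈-concatMap⁺′ (A-children q) (∈-allFin r) (∈-map⁺ (_∷ r ∷ q) a∈A))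

  S⊆V : All (_∈ vertices C L) S
  S⊆V = All.tabulate S-vertex
    where
    S-vertex : ∀ {w} → w ∈ S → w ∈ vertices C L
    S-vertex w∈S with q , q∈ , w∈q ← ∈-concatMap⁻′ A-grandchildren (wordsOfLength C n) w∈S
                 with r , _ , w∈qr ← ∈-concatMap⁻′ (A-children q) (allFin C) w∈q
                 with _ , _ , refl ← ∈-map⁻ _ w∈qr =
      ∈-vertices⁺ L (ℕ.m≤n⇒m≤1+n (ℕ.≤-reflexive (cong (2 +_) (∈-wordsOfLength⁻ n q∈))))

  length-S : length S ≡ s * C ^ suc n
  length-S = begin
    length S
      ≡⟨ length-concatMap A-grandchildren |A-grandchildren| (wordsOfLength C n) ⟩
    length (wordsOfLength C n) * (length (allFin C) * s)
      ≡⟨ cong₂ (λ a b → a * (b * s)) (length-wordsOfLength n) (length-allFin C) ⟩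
    C ^ n * (C * s) ≡⟨ ℕ.*-comm (C ^ n) (C * s) ⟩
    C * s * C ^ n   ≡⟨ cong (_* C ^ n) (ℕ.*-comm C s) ⟩
    s * C * C ^ n   ≡⟨ ℕ.*-assoc s C (C ^ n) ⟩
    s * C ^ suc n   ∎
    where
    open ≡-Reasoning
    |A-children| : ∀ q r → length (A-children q r) ≡ s
    |A-children| q r = trans (length-map _ (A r)) (length-applyUpTo _ s)
    |A-grandchildren| : ∀ q → length (A-grandchildren q) ≡ length (allFin C) * s
    |A-grandchildren| q = length-concatMap (A-children q) (|A-children| q) (allFin C)

  kPDS-of-size : ∃[ S ] (isKPDS C L k S × length S ≡ s * C ^ suc n)
  kPDS-of-size = S , Observation.S-isKPDS S S⊆V A-children∈S , length-S

γPk-formula : ∀ s k n → 0 < s → 0 < k →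
              γPk≡ (suc (s + k)) (3 + n) k (s * suc (s + k) ^ suc n)
γPk-formula s k n 0<s 0<k =
  UpperBound.kPDS-of-size s k n 0<s 0<k ,
  λ S (S⊆V , observedAll) → LowerBound.kPDS-size-≥ (suc (s + k)) (suc n) k S S⊆V
                              (ℕ.≤-reflexive (ℕ.+-suc s k)) observedAll

mainTheorem7 : (C L k : ℕ) → 3 ≤ C → 3 ≤ L → 1 ≤ k → k ≤ C ∸ 2 →
    γPk≡ C L k ((C ∸ k ∸ 1) * C ^ (L ∸ 2))
mainTheorem7 C L k 3≤C (s≤s (s≤s (s≤s {n = n} _))) 0<k k≤C∸2 =
  subst (λ C′ → γPk≡ C′ L k (s * C′ ^ suc n)) C≡ (γPk-formula s k n 0<s 0<k)
  where
  s = C ∸ k ∸ 1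

  2+k≤C : 2 + k ≤ C
  2+k≤C = subst (_≤ C) (ℕ.+-comm k 2)
            (ℕ.m≤o∸n⇒m+n≤o k (ℕ.≤-trans (ℕ.n≤1+n 2) 3≤C) k≤C∸2)

  2≤C∸k : 2 ≤ C ∸ k
  2≤C∸k = ℕ.m+n≤o⇒m≤o∸n 2 2+k≤C

  0<s : 0 < s
  0<s = ℕ.m+n≤o⇒m≤o∸n 1 2≤C∸k

  C≡ : suc (s + k) ≡ C
  C≡ = begin
    suc s + k   ≡⟨ cong (_+ k) (ℕ.+-comm 1 s) ⟩
    s + 1 + k   ≡⟨ cong (_+ k) (ℕ.m∸n+n≡m (ℕ.≤-trans (ℕ.n≤1+n 1) 2≤C∸k)) ⟩
    C ∸ k + k   ≡⟨ ℕ.m∸n+n≡m (ℕ.≤-trans (ℕ.m≤n+m k 2) 2+k≤C) ⟩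
    C           ∎
    where open ≡-Reasoning
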